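{- Let $n\geq 2$ and $d\geq 1$ be integers, and let $H_n^d$ denote the labeling of the vertices of $P_n^d$ by their position $1,2,\ldots,(n+1)^d$ in the Hales order. Then \[ bw(H_n^d)=\sum_{i=0}^{d-1}\mathcal{R}(n,i), \] where $\mathcal{R}(n,i)$ is the sum of the $n$ largest coefficients (counted with multiplicity, among the $ni+1$ coefficients of $x^0,\ldots,x^{ni}$) of the polynomial $(1+x+x^2+\cdots+x^n)^i$, with missing coefficients treated as $0$ (so $\mathcal{R}(n,0)=1$).
   Context: $P_n^d$ is the graph with vertex set $\{0,1,\ldots,n\}^d$, two vertices adjacent iff they differ in exactly one coordinate, and there by absolute difference $1$. For a labeling $f$ (a bijection from the vertex set to $\{1,\ldots,N\}$), $bw(f)=\max_{(u,v)\in E}|f(u)-f(v)|$. The weight $w(x)$ of $x$ is the sum of its coordinates. The Hales order: $u\leq v$ iff $w(u)<w(v)$, or $w(u)=w(v)$ and $u$ is greater than or equal to $v$ in the lexicographic order comparing coordinates from right to left (last coordinate first); e.g. for $n=d=2$: $00<01<10<02<11<20<12<21<22$. -}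

module Defs where

open import Data.Nat using (ℕ; zero; suc; _+_; _*_; _∸_; _<ᵇ_; _≡ᵇ_; ∣_-_∣; _⊔_)
open import Data.Nat.Properties using (≤-decTotalOrder)
open import Data.Bool using (Bool; true; false; _∧_; _∨_; if_then_else_)
open import Data.Fin using (Fin; toℕ)
open import Data.Vec using (Vec; []; _∷_)
open import Data.List using (List; []; _∷_; [_]; map; concatMap; filter; length; upTo; take; reverse; foldr; allFin)
open import Data.List.Sort.InsertionSort ≤-decTotalOrder using (sort)
open import Data.Nat.ListAction using (sum)
open import Relation.Nullary.Decidable using (⌊_⌋)
open import Data.Bool using (T?)

Vertex : ℕ → ℕ → Set
Vertex n d = Vec (Fin (suc n)) d

vertices : (n d : ℕ) → List (Vertex n d)
vertices n zero    = [ [] ]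
vertices n (suc d) = concatMap (λ i → map (i ∷_) (vertices n d)) (allFin (suc n))

eqV : ∀ {n d} → Vertex n d → Vertex n d → Bool
eqV []       []       = true
eqV (x ∷ xs) (y ∷ ys) = (toℕ x ≡ᵇ toℕ y) ∧ eqV xs ys

-- adjacency in P_n^d: differ in exactly one coordinate, there by absolute difference 1
adjᵇ : ∀ {n d} → Vertex n d → Vertex n d → Bool
adjᵇ []       []       = false
adjᵇ (x ∷ xs) (y ∷ ys) =
  ((toℕ x ≡ᵇ toℕ y) ∧ adjᵇ xs ys) ∨ ((∣ toℕ x - toℕ y ∣ ≡ᵇ 1) ∧ eqV xs ys)

weight : ∀ {n d} → Vertex n d → ℕ
weight []       = 0
weight (x ∷ xs) = toℕ x + weight xs

-- strict lexicographic "greater than", comparing coordinates from right to left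
-- (last coordinate first)
revLexGt : ∀ {n d} → Vertex n d → Vertex n d → Bool
revLexGt []       []       = false
revLexGt (x ∷ xs) (y ∷ ys) = revLexGt xs ys ∨ (eqV xs ys ∧ (toℕ y <ᵇ toℕ x))

halesLt : ∀ {n d} → Vertex n d → Vertex n d → Bool
halesLt u v = (weight u <ᵇ weight v) ∨ ((weight u ≡ᵇ weight v) ∧ revLexGt u v)

hales : (n d : ℕ) → Vertex n d → ℕ
hales n d x = suc (length (filter (λ y → T? (halesLt y x)) (vertices n d)))

bw : (n d : ℕ) → (Vertex n d → ℕ) → ℕ
bw n d f = foldr _⊔_ 0
  (concatMap (λ u → concatMap (λ v → if adjᵇ u v then [ ∣ f u - f v ∣ ] else [])
                               (vertices n d))
             (vertices n d))

coef : ℕ → ℕ → ℕ → ℕ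
coef n zero    zero    = 1
coef n zero    (suc k) = 0
coef n (suc i) k       =
  sum (map (λ j → if k <ᵇ j then 0 else coef n i (k ∸ j)) (upTo (suc n)))

coeffs : ℕ → ℕ → List ℕ
coeffs n i = map (coef n i) (upTo (suc (n * i)))

R : ℕ → ℕ → ℕ
R n i = sum (take n (reverse (sort (coeffs n i))))

private
  open import Relation.Binary.PropositionalEquality using (_≡_; refl)
  t1 : R 2 0 ≡ 1
  t1 = refl
  t2 : coeffs 2 2 ≡ 1 ∷ 2 ∷ 3 ∷ 2 ∷ 1 ∷ []
  t2 = refl
  t3 : R 2 2 ≡ 5
  t3 = refl
  t4 : map (hales 2 2) (vertices 2 2) ≡ 1 ∷ 2 ∷ 4 ∷ 3 ∷ 5 ∷ 7 ∷ 6 ∷ 8 ∷ 9 ∷ []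
  t4 = refl
  t5 : bw 2 2 (hales 2 2) ≡ 1 + R 2 1
  t5 = refl

module Submission where

-- The Hales label of u is one more than its rank: the number of vertices of smaller weight
-- plus the number of vertices of the same weight that precede u. Hence across an edge from u
-- to v, with w(v) = w(u) + 1, the labels differ by gap u v, the number of vertices of weight
-- w(u) from u on plus the number of vertices of weight w(v) before v. The last coordinate is
-- the most significant one in the order, and splitting it off shows that gap grows, from
-- dimension d to d + 1, by the sum of n consecutive level sizes of P_n^d, i.e. of n
-- consecutive coefficients of (1 + x + ⋯ + x^n)^d. Such a window never exceeds R(n,d): for
-- every threshold t, any n of the coefficients c_j sum to at most n t + Σ_j (c_j ∸ t), and
-- for t the (n+1)-st largest coefficient the n largest attain it. Summing over d bounds the
-- bandwidth from above. Conversely the coefficients are symmetric and unimodal, so the central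
-- window attains R(n,d), and the edge whose coordinate prefixes have the central weights
-- ⌊(n k + n)/2⌋ collects a central window in every dimension.


open import Defs
open import Data.Nat using (ℕ; _≤_)
open import Data.List using (map; upTo)
open import Data.Nat.ListAction using (sum)
open import Relation.Binary.PropositionalEquality using (_≡_)

open import Data.Bool using (Bool; true; false; _∧_; _∨_; not; if_then_else_; T?)
open import Data.Bool.Properties using (∧-identityʳ; ∧-assoc; ∧-zeroʳ; ∨-zeroʳ)
open import Data.Empty using (⊥-elim)
open import Data.Fin using (Fin; toℕ; fromℕ<; opposite) renaming (zero to fzero; suc to fsuc)
open import Data.Fin.Permutation using () renaming (reverse to reversal)
open import Data.Fin.Properties using (toℕ-injective; toℕ<n; toℕ-fromℕ<; opposite-prop)
open import Data.List using (List; []; _∷_; [_]; concatMap; filter; length; take; reverse; foldr; tabulate; applyUpTo; _++_)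
open import Data.List.Properties using (take-[]; unfold-reverse; map-++; map-∘; map-cong; map-upTo; upTo-∷ʳ)
open import Data.Nat
  using (zero; suc; _+_; _*_; _∸_; _<_; _≥_; _<ᵇ_; _≡ᵇ_; ∣_-_∣; _⊔_; ⌊_/2⌋; z≤n; s≤s; z<s; s<s; s<s⁻¹; s≤s⁻¹)
open import Data.Nat.ListAction.Properties using (sum-++; sum-↭)
open import Data.Nat.Properties
open import Data.Nat.Solver using (module +-*-Solver)
open import Data.Product using (Σ; _×_; _,_; proj₁)
open import Data.List.Membership.Propositional using (_∈_; lose)
open import Data.List.Membership.Propositional.Properties using (∈-concatMap⁺; ∈-map⁺; ∈-allFin)
open import Data.List.Relation.Unary.Any using (here; there)
open import Data.List.Relation.Unary.All using (All; []; _∷_)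
import Data.List.Relation.Unary.All as All
open import Data.List.Relation.Unary.AllPairs using (AllPairs; []; _∷_)
import Data.List.Relation.Unary.AllPairs.Properties as AllPairs
open import Data.List.Relation.Unary.Linked.Properties using (Linked⇒AllPairs)
open import Data.List.Relation.Binary.Permutation.Propositional using (↭-sym; ↭-trans)
import Data.List.Relation.Binary.Permutation.Propositional.Properties as Perm
open import Data.List.Sort.InsertionSort ≤-decTotalOrder using (sort)
open import Data.List.Sort.InsertionSort.Properties ≤-decTotalOrder using (sort-↭; sort-↗)
open import Data.Sum using (_⊎_; inj₁; inj₂)
open import Data.Vec using ([]; _∷_; _∷ʳ_; initLast)
import Data.Vec as Vec
open import Function using (_∘_; flip)
open import Relation.Nullary using (yes; no)
open import Relation.Binary.PropositionalEquality using (_≢_; refl; sym; trans; cong; cong₂; subst; subst₂; module ≡-Reasoning)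

open import Algebra.Properties.CommutativeMonoid.Sum +-0-commutativeMonoid
  using (sum-syntax; sum-cong-≗; ∑-distrib-+; ∑-comm; sum-permute)
open import Algebra.Properties.CommutativeSemigroup +-commutativeSemigroup using (interchange)
open +-*-Solver using (solve; _:+_; _:=_; con)
open ≡-Reasoning

-- sum-cong-≗ with the summands as implicit arguments, so that they can be inferred
-- from the pointwise equation.
∑-cong : ∀ {m} {f g : Fin m → ℕ} → (∀ i → f i ≡ g i) → ∑[ i < m ] f i ≡ ∑[ i < m ] g i
∑-cong {m} {f} {g} = sum-cong-≗ {m} {f} {g}

sumTo : ℕ → (ℕ → ℕ) → ℕ
sumTo m f = ∑[ i < m ] f (toℕ i)

sumTo-cong : ∀ m {f g : ℕ → ℕ} → (∀ i → i < m → f i ≡ g i) → sumTo m f ≡ sumTo m g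
sumTo-cong m {f} {g} eq = ∑-cong {m} {f ∘ toℕ} {g ∘ toℕ} (λ i → eq (toℕ i) (toℕ<n i))

sumTo-cong-≗ : ∀ m {f g : ℕ → ℕ} → (∀ i → f i ≡ g i) → sumTo m f ≡ sumTo m g
sumTo-cong-≗ m {f} {g} eq = ∑-cong {m} {f ∘ toℕ} {g ∘ toℕ} (λ i → eq (toℕ i))

sumTo-distrib-+ : ∀ m (f g : ℕ → ℕ) → sumTo m (λ i → f i + g i) ≡ sumTo m f + sumTo m g
sumTo-distrib-+ m f g = ∑-distrib-+ {m} (f ∘ toℕ) (g ∘ toℕ)

sumTo-comm : ∀ m k (f : ℕ → ℕ → ℕ) → sumTo m (λ i → sumTo k (f i)) ≡ sumTo k (λ j → sumTo m (λ i → f i j))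
sumTo-comm m k f = ∑-comm {m} {k} (λ i j → f (toℕ i) (toℕ j))

sumTo-suc : ∀ m f → sumTo (suc m) f ≡ sumTo m f + f m
sumTo-suc zero    f = +-identityʳ (f 0)
sumTo-suc (suc m) f = trans (cong (f 0 +_) (sumTo-suc m (f ∘ suc))) (sym (+-assoc (f 0) _ _))

sumTo-zero : ∀ m → sumTo m (λ _ → 0) ≡ 0
sumTo-zero zero    = refl
sumTo-zero (suc m) = sumTo-zero m

sumTo-const : ∀ m c → sumTo m (λ _ → c) ≡ m * c
sumTo-const zero    c = refl
sumTo-const (suc m) c = cong (c +_) (sumTo-const m c)

sumTo-mono : ∀ m {f g : ℕ → ℕ} → (∀ i → i < m → f i ≤ g i) → sumTo m f ≤ sumTo m g
sumTo-mono zero    le = z≤n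
sumTo-mono (suc m) le = +-mono-≤ (le 0 z<s) (sumTo-mono m (λ i i<m → le (suc i) (s<s i<m)))

sumTo-indicator : ∀ m c (f : ℕ → ℕ) → c < m → sumTo m (λ i → if i ≡ᵇ c then f i else 0) ≡ f c
sumTo-indicator (suc m) zero    f _         = trans (cong (f 0 +_) (sumTo-zero m)) (+-identityʳ (f 0))
sumTo-indicator (suc m) (suc c) f (s<s c<m) = sumTo-indicator m c (f ∘ suc) c<m

sumTo-indicator-≥ : ∀ m c (f : ℕ → ℕ) → m ≤ c → sumTo m (λ i → if i ≡ᵇ c then f i else 0) ≡ 0
sumTo-indicator-≥ zero    c       f _         = refl
sumTo-indicator-≥ (suc m) (suc c) f (s≤s m≤c) = sumTo-indicator-≥ m c (f ∘ suc) m≤c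

sumTo-indicator-≤ : ∀ m c (f : ℕ → ℕ) → sumTo m (λ i → if i ≡ᵇ c then f i else 0) ≤ f c
sumTo-indicator-≤ m c f with c <? m
... | yes c<m = ≤-reflexive (sumTo-indicator m c f c<m)
... | no  c≮m = ≤-trans (≤-reflexive (sumTo-indicator-≥ m c f (≮⇒≥ c≮m))) z≤n

sum-map-upTo : ∀ m f → sum (map f (upTo m)) ≡ sumTo m f
sum-map-upTo m f = trans (cong sum (map-upTo f m)) (sum-applyUpTo m f)
  where
  sum-applyUpTo : ∀ m f → sum (applyUpTo f m) ≡ sumTo m f
  sum-applyUpTo zero    f = refl
  sum-applyUpTo (suc m) f = cong (f 0 +_) (sum-applyUpTo m (f ∘ suc))

sum-map-cong : ∀ {A : Set} (xs : List A) {f g : A → ℕ} → (∀ x → f x ≡ g x) → sum (map f xs) ≡ sum (map g xs)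
sum-map-cong xs eq = cong sum (map-cong eq xs)

sum-map-+ : ∀ {A : Set} (xs : List A) (f g : A → ℕ) → sum (map (λ x → f x + g x) xs) ≡ sum (map f xs) + sum (map g xs)
sum-map-+ []       f g = refl
sum-map-+ (x ∷ xs) f g = trans (cong ((f x + g x) +_) (sum-map-+ xs f g)) (interchange (f x) (g x) _ _)

sum-map-zero : ∀ {A : Set} (xs : List A) → sum (map (λ _ → 0) xs) ≡ 0
sum-map-zero []       = refl
sum-map-zero (x ∷ xs) = sum-map-zero xs

sum-map-concatMap-tabulate : ∀ {m} {A B : Set} (f : B → ℕ) (g : A → List B) (h : Fin m → A) →
  sum (map f (concatMap g (tabulate h))) ≡ ∑[ i < m ] sum (map f (g (h i)))
sum-map-concatMap-tabulate {zero}  f g h = refl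
sum-map-concatMap-tabulate {suc m} f g h = begin
  sum (map f (g (h fzero) ++ concatMap g (tabulate (h ∘ fsuc))))
    ≡⟨ cong sum (map-++ f (g (h fzero)) _) ⟩
  sum (map f (g (h fzero)) ++ map f (concatMap g (tabulate (h ∘ fsuc))))
    ≡⟨ sum-++ (map f (g (h fzero))) _ ⟩
  sum (map f (g (h fzero))) + sum (map f (concatMap g (tabulate (h ∘ fsuc))))
    ≡⟨ cong (sum (map f (g (h fzero))) +_) (sum-map-concatMap-tabulate f g (h ∘ fsuc)) ⟩
  sum (map f (g (h fzero))) + ∑[ i < m ] sum (map f (g (h (fsuc i)))) ∎

∑V : ∀ n d → (Vertex n d → ℕ) → ℕ
∑V n d f = sum (map f (vertices n d))

∑V-cong : ∀ n d {f g : Vertex n d → ℕ} → (∀ x → f x ≡ g x) → ∑V n d f ≡ ∑V n d g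
∑V-cong n d = sum-map-cong (vertices n d)

∑V-distrib-+ : ∀ n d (f g : Vertex n d → ℕ) → ∑V n d (λ x → f x + g x) ≡ ∑V n d f + ∑V n d g
∑V-distrib-+ n d = sum-map-+ (vertices n d)

∑V-zero : ∀ n d → ∑V n d (λ _ → 0) ≡ 0
∑V-zero n d = sum-map-zero (vertices n d)

∑V-∷ : ∀ n d (f : Vertex n (suc d) → ℕ) → ∑V n (suc d) f ≡ ∑[ i < suc n ] ∑V n d (λ y → f (i ∷ y))
∑V-∷ n d f = trans (sum-map-concatMap-tabulate f (λ i → map (i ∷_) (vertices n d)) (λ i → i))
  (∑-cong {suc n} (λ i → cong sum (sym (map-∘ {g = f} {f = i ∷_} (vertices n d)))))

∑V-∷ʳ : ∀ n d (f : Vertex n (suc d) → ℕ) → ∑V n (suc d) f ≡ ∑[ a < suc n ] ∑V n d (λ s → f (s ∷ʳ a))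
∑V-∷ʳ n zero    f = ∑V-∷ n zero f
∑V-∷ʳ n (suc d) f = begin
  ∑V n (suc (suc d)) f                                          ≡⟨ ∑V-∷ n (suc d) f ⟩
  ∑[ i < suc n ] ∑V n (suc d) (λ y → f (i ∷ y))
    ≡⟨ ∑-cong {suc n} (λ i → ∑V-∷ʳ n d (λ y → f (i ∷ y))) ⟩
  ∑[ i < suc n ] ∑[ a < suc n ] ∑V n d (λ s → f (i ∷ (s ∷ʳ a)))
    ≡⟨ ∑-comm {suc n} {suc n} (λ i a → ∑V n d (λ s → f (i ∷ (s ∷ʳ a)))) ⟩
  ∑[ a < suc n ] ∑[ i < suc n ] ∑V n d (λ s → f (i ∷ (s ∷ʳ a)))
    ≡⟨ ∑-cong {suc n} (λ a → sym (∑V-∷ n d (λ y → f (y ∷ʳ a)))) ⟩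
  ∑[ a < suc n ] ∑V n (suc d) (λ s → f (s ∷ʳ a))                ∎

∧≡true : ∀ {a b : Bool} → (a ∧ b) ≡ true → (a ≡ true) × (b ≡ true)
∧≡true {true} {true} _ = refl , refl

∨≡true : ∀ {a b : Bool} → (a ∨ b) ≡ true → (a ≡ true) ⊎ (b ≡ true)
∨≡true {true}         _ = inj₁ refl
∨≡true {false} {true} _ = inj₂ refl

≡ᵇ-true⇒≡ : ∀ m n → (m ≡ᵇ n) ≡ true → m ≡ n
≡ᵇ-true⇒≡ zero    zero    _ = refl
≡ᵇ-true⇒≡ (suc m) (suc n) e = cong suc (≡ᵇ-true⇒≡ m n e)

≡ᵇ-refl : ∀ m → (m ≡ᵇ m) ≡ true
≡ᵇ-refl zero    = refl
≡ᵇ-refl (suc m) = ≡ᵇ-refl m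

≢⇒≡ᵇ-false : ∀ m n → m ≢ n → (m ≡ᵇ n) ≡ false
≢⇒≡ᵇ-false m n m≢n with m ≡ᵇ n in eq
... | true  = ⊥-elim (m≢n (≡ᵇ-true⇒≡ m n eq))
... | false = refl

≡⇒≡ᵇ-true : ∀ {m n} → m ≡ n → (m ≡ᵇ n) ≡ true
≡⇒≡ᵇ-true {m} refl = ≡ᵇ-refl m

≡ᵇ-cong-⇔ : ∀ {x y x′ y′} → (x ≡ y → x′ ≡ y′) → (x′ ≡ y′ → x ≡ y) → (x ≡ᵇ y) ≡ (x′ ≡ᵇ y′)
≡ᵇ-cong-⇔ {x} {y} {x′} {y′} to from with x ≡ᵇ y in eq | x′ ≡ᵇ y′ in eq′
... | true  | true  = refl
... | false | false = refl
... | true  | false with () ← trans (sym (≡⇒≡ᵇ-true (to (≡ᵇ-true⇒≡ x y eq)))) eq′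
... | false | true  with () ← trans (sym (≡⇒≡ᵇ-true (from (≡ᵇ-true⇒≡ x′ y′ eq′)))) eq

≡ᵇ-sym : ∀ m n → (m ≡ᵇ n) ≡ (n ≡ᵇ m)
≡ᵇ-sym m n = ≡ᵇ-cong-⇔ (sym {x = m}) sym

≡ᵇ-cancelˡ : ∀ a x y → (a + x ≡ᵇ a + y) ≡ (x ≡ᵇ y)
≡ᵇ-cancelˡ a x y = ≡ᵇ-cong-⇔ (+-cancelˡ-≡ a x y) (cong (a +_))

≡ᵇ-cancelʳ : ∀ x y a → (x + a ≡ᵇ y + a) ≡ (x ≡ᵇ y)
≡ᵇ-cancelʳ x y a = ≡ᵇ-cong-⇔ (+-cancelʳ-≡ a x y) (cong (_+ a))

≡ᵇ-cancelʳ′ : ∀ x y a b → (a ≡ᵇ b) ≡ true → (x + a ≡ᵇ y + b) ≡ (x ≡ᵇ y)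
≡ᵇ-cancelʳ′ x y a b a≡b rewrite ≡ᵇ-true⇒≡ a b a≡b = ≡ᵇ-cancelʳ x y b

<ᵇ-true⇒< : ∀ m n → (m <ᵇ n) ≡ true → m < n
<ᵇ-true⇒< zero    (suc n) _ = z<s
<ᵇ-true⇒< (suc m) (suc n) e = s<s (<ᵇ-true⇒< m n e)

<ᵇ-false⇒≥ : ∀ m n → (m <ᵇ n) ≡ false → n ≤ m
<ᵇ-false⇒≥ m       zero    _ = z≤n
<ᵇ-false⇒≥ (suc m) (suc n) e = s≤s (<ᵇ-false⇒≥ m n e)

≥⇒<ᵇ-false : ∀ {m n} → n ≤ m → (m <ᵇ n) ≡ false
≥⇒<ᵇ-false {m}     {zero}  _         = refl
≥⇒<ᵇ-false {suc m} {suc n} (s≤s n≤m) = ≥⇒<ᵇ-false n≤m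

<ᵇ-true⇒≡ᵇ-false : ∀ a b → (b <ᵇ a) ≡ true → (a ≡ᵇ b) ≡ false
<ᵇ-true⇒≡ᵇ-false (suc a) zero    _ = refl
<ᵇ-true⇒≡ᵇ-false (suc a) (suc b) e = <ᵇ-true⇒≡ᵇ-false a b e

<ᵇ-trichotomy : ∀ a b → (a <ᵇ b) ≡ not ((b <ᵇ a) ∨ (a ≡ᵇ b))
<ᵇ-trichotomy zero    zero    = refl
<ᵇ-trichotomy zero    (suc b) = refl
<ᵇ-trichotomy (suc a) zero    = refl
<ᵇ-trichotomy (suc a) (suc b) = <ᵇ-trichotomy a b

𝟙 : Bool → ℕ
𝟙 b = if b then 1 else 0

length-filter≡∑𝟙 : ∀ {A : Set} (P : A → Bool) (xs : List A) →
  length (filter (λ y → T? (P y)) xs) ≡ sum (map (λ y → 𝟙 (P y)) xs)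
length-filter≡∑𝟙 P []       = refl
length-filter≡∑𝟙 P (x ∷ xs) with P x
... | true  = cong suc (length-filter≡∑𝟙 P xs)
... | false = length-filter≡∑𝟙 P xs

rank : ∀ {n d} → Vertex n d → ℕ
rank {n} {d} x = ∑V n d (λ y → 𝟙 (halesLt y x))

hales≡suc-rank : ∀ n d x → hales n d x ≡ suc (rank x)
hales≡suc-rank n d x = cong suc (length-filter≡∑𝟙 (λ y → halesLt y x) (vertices n d))

weight-∷ʳ : ∀ {n d} (xs : Vertex n d) a → weight (xs ∷ʳ a) ≡ weight xs + toℕ a
weight-∷ʳ []       a = +-identityʳ (toℕ a)
weight-∷ʳ (x ∷ xs) a = trans (cong (toℕ x +_) (weight-∷ʳ xs a)) (sym (+-assoc (toℕ x) _ _))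

eqV-∷ʳ : ∀ {n d} (xs ys : Vertex n d) a b → eqV (xs ∷ʳ a) (ys ∷ʳ b) ≡ (eqV xs ys ∧ (toℕ a ≡ᵇ toℕ b))
eqV-∷ʳ []       []       a b = ∧-identityʳ _
eqV-∷ʳ (x ∷ xs) (y ∷ ys) a b = trans (cong ((toℕ x ≡ᵇ toℕ y) ∧_) (eqV-∷ʳ xs ys a b))
  (sym (∧-assoc (toℕ x ≡ᵇ toℕ y) _ _))

revLexGt-∷ʳ : ∀ {n d} (xs ys : Vertex n d) a b →
  revLexGt (xs ∷ʳ a) (ys ∷ʳ b) ≡ ((toℕ b <ᵇ toℕ a) ∨ ((toℕ a ≡ᵇ toℕ b) ∧ revLexGt xs ys))
revLexGt-∷ʳ [] [] a b with toℕ b <ᵇ toℕ a | toℕ a ≡ᵇ toℕ b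
... | true  | _     = refl
... | false | true  = refl
... | false | false = refl
revLexGt-∷ʳ (x ∷ xs) (y ∷ ys) a b = begin
  revLexGt (xs ∷ʳ a) (ys ∷ʳ b) ∨ (eqV (xs ∷ʳ a) (ys ∷ʳ b) ∧ Y)
    ≡⟨ cong₂ (λ p q → p ∨ (q ∧ Y)) (revLexGt-∷ʳ xs ys a b) (eqV-∷ʳ xs ys a b) ⟩
  (B ∨ (Q ∧ revLexGt xs ys)) ∨ ((eqV xs ys ∧ Q) ∧ Y)
    ≡⟨ reassociate B (eqV xs ys) Q (revLexGt xs ys) Y ⟩
  B ∨ (Q ∧ (revLexGt xs ys ∨ (eqV xs ys ∧ Y))) ∎
  where
  B = toℕ b <ᵇ toℕ a
  Q = toℕ a ≡ᵇ toℕ b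
  Y = toℕ y <ᵇ toℕ x
  reassociate : ∀ B E Q R Y → ((B ∨ (Q ∧ R)) ∨ ((E ∧ Q) ∧ Y)) ≡ (B ∨ (Q ∧ (R ∨ (E ∧ Y))))
  reassociate true  E     Q     R     Y = refl
  reassociate false true  true  R     Y = refl
  reassociate false false true  R     Y = refl
  reassociate false true  false R     Y = refl
  reassociate false false false R     Y = refl

adjᵇ-∷ʳ : ∀ {n d} (xs ys : Vertex n d) a b →
  adjᵇ (xs ∷ʳ a) (ys ∷ʳ b) ≡ ((eqV xs ys ∧ (∣ toℕ a - toℕ b ∣ ≡ᵇ 1)) ∨ ((toℕ a ≡ᵇ toℕ b) ∧ adjᵇ xs ys))
adjᵇ-∷ʳ [] [] a b with toℕ a ≡ᵇ toℕ b | ∣ toℕ a - toℕ b ∣ ≡ᵇ 1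
... | true  | true  = refl
... | true  | false = refl
... | false | true  = refl
... | false | false = refl
adjᵇ-∷ʳ (x ∷ xs) (y ∷ ys) a b = begin
  (X ∧ adjᵇ (xs ∷ʳ a) (ys ∷ʳ b)) ∨ (Y ∧ eqV (xs ∷ʳ a) (ys ∷ʳ b))
    ≡⟨ cong₂ (λ p q → (X ∧ p) ∨ (Y ∧ q)) (adjᵇ-∷ʳ xs ys a b) (eqV-∷ʳ xs ys a b) ⟩
  (X ∧ ((eqV xs ys ∧ D) ∨ (Q ∧ adjᵇ xs ys))) ∨ (Y ∧ (eqV xs ys ∧ Q))
    ≡⟨ reassociate X Y (eqV xs ys) D Q (adjᵇ xs ys) ⟩
  ((X ∧ eqV xs ys) ∧ D) ∨ (Q ∧ ((X ∧ adjᵇ xs ys) ∨ (Y ∧ eqV xs ys))) ∎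
  where
  X = toℕ x ≡ᵇ toℕ y
  Y = ∣ toℕ x - toℕ y ∣ ≡ᵇ 1
  D = ∣ toℕ a - toℕ b ∣ ≡ᵇ 1
  Q = toℕ a ≡ᵇ toℕ b
  reassociate : ∀ X Y E D Q J →
    ((X ∧ ((E ∧ D) ∨ (Q ∧ J))) ∨ (Y ∧ (E ∧ Q))) ≡ (((X ∧ E) ∧ D) ∨ (Q ∧ ((X ∧ J) ∨ (Y ∧ E))))
  reassociate true  true  true  true  Q     J = refl
  reassociate true  true  true  false true  J = refl
  reassociate true  true  true  false false J = refl
  reassociate true  true  false D     true  J = refl
  reassociate true  true  false D     false J = refl
  reassociate true  false true  true  Q     J = refl
  reassociate true  false true  false true  J = refl
  reassociate true  false true  false false J = refl
  reassociate true  false false D     true  J = refl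
  reassociate true  false false D     false J = refl
  reassociate false true  true  D     true  J = refl
  reassociate false true  true  D     false J = refl
  reassociate false true  false D     true  J = refl
  reassociate false true  false D     false J = refl
  reassociate false false E     D     true  J = refl
  reassociate false false E     D     false J = refl

eqV-true⇒≡ : ∀ {n d} (xs ys : Vertex n d) → eqV xs ys ≡ true → xs ≡ ys
eqV-true⇒≡ []       []       _ = refl
eqV-true⇒≡ (x ∷ xs) (y ∷ ys) e with ∧≡true {toℕ x ≡ᵇ toℕ y} e
... | x≡y , xs≡ys = cong₂ _∷_ (toℕ-injective (≡ᵇ-true⇒≡ _ _ x≡y)) (eqV-true⇒≡ xs ys xs≡ys)

eqV-sym : ∀ {n d} (xs ys : Vertex n d) → eqV xs ys ≡ eqV ys xs
eqV-sym []       []       = refl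
eqV-sym (x ∷ xs) (y ∷ ys) = cong₂ _∧_ (≡ᵇ-sym (toℕ x) (toℕ y)) (eqV-sym xs ys)

adjᵇ-sym : ∀ {n d} (xs ys : Vertex n d) → adjᵇ xs ys ≡ adjᵇ ys xs
adjᵇ-sym []       []       = refl
adjᵇ-sym (x ∷ xs) (y ∷ ys) =
  cong₂ _∨_ (cong₂ _∧_ (≡ᵇ-sym (toℕ x) (toℕ y)) (adjᵇ-sym xs ys))
            (cong₂ _∧_ (cong (_≡ᵇ 1) (∣-∣-comm (toℕ x) (toℕ y))) (eqV-sym xs ys))

∣-∣≡ᵇ1⇒suc : ∀ m n → (∣ m - n ∣ ≡ᵇ 1) ≡ true → (n ≡ suc m) ⊎ (m ≡ suc n)
∣-∣≡ᵇ1⇒suc zero       (suc zero) _ = inj₁ refl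
∣-∣≡ᵇ1⇒suc (suc zero) zero       _ = inj₂ refl
∣-∣≡ᵇ1⇒suc (suc m)    (suc n)    e with ∣-∣≡ᵇ1⇒suc m n e
... | inj₁ p = inj₁ (cong suc p)
... | inj₂ p = inj₂ (cong suc p)

adjᵇ⇒weight-suc : ∀ {n d} (xs ys : Vertex n d) → adjᵇ xs ys ≡ true →
  (weight ys ≡ suc (weight xs)) ⊎ (weight xs ≡ suc (weight ys))
adjᵇ⇒weight-suc []       []       ()
adjᵇ⇒weight-suc (x ∷ xs) (y ∷ ys) e with ∨≡true {(toℕ x ≡ᵇ toℕ y) ∧ adjᵇ xs ys} e
... | inj₁ e₁ with ∧≡true {toℕ x ≡ᵇ toℕ y} e₁
...   | x≡y , adj with ≡ᵇ-true⇒≡ _ _ x≡y | adjᵇ⇒weight-suc xs ys adj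
...     | p | inj₁ r = inj₁ (trans (cong₂ _+_ (sym p) r) (+-suc (toℕ x) (weight xs)))
...     | p | inj₂ r = inj₂ (trans (cong₂ _+_ p r) (+-suc (toℕ y) (weight ys)))
adjᵇ⇒weight-suc (x ∷ xs) (y ∷ ys) e | inj₂ e₂ with ∧≡true {∣ toℕ x - toℕ y ∣ ≡ᵇ 1} e₂
...   | dist , xs≡ys with eqV-true⇒≡ xs ys xs≡ys | ∣-∣≡ᵇ1⇒suc (toℕ x) (toℕ y) dist
...     | refl | inj₁ r = inj₁ (cong (_+ weight xs) r)
...     | refl | inj₂ r = inj₂ (cong (_+ weight xs) r)

-- Levels and the label gap across an edge

level : ∀ n d → ℕ → ℕ
level n d m = ∑V n d (λ y → 𝟙 (weight y ≡ᵇ m))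

-- levelShift n d m a is the size of level m ∸ a when a ≤ m, but 0 when a > m.
levelShift : ∀ n d → ℕ → ℕ → ℕ
levelShift n d m a = ∑V n d (λ y → 𝟙 (weight y + a ≡ᵇ m))

below : ∀ n d → ℕ → ℕ
below n d m = ∑V n d (λ y → 𝟙 (weight y <ᵇ m))

levelBefore : ∀ {n d} → Vertex n d → ℕ
levelBefore {n} {d} u = ∑V n d (λ y → 𝟙 ((weight y ≡ᵇ weight u) ∧ revLexGt y u))

levelFrom : ∀ {n d} → Vertex n d → ℕ
levelFrom {n} {d} u = ∑V n d (λ y → 𝟙 ((weight y ≡ᵇ weight u) ∧ not (revLexGt y u)))

gap : ∀ {n d} → Vertex n d → Vertex n d → ℕ
gap u v = levelFrom u + levelBefore v

window : ∀ n d → ℕ → ℕ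
window n d W = sumTo n (levelShift n d W)

rank≡below+levelBefore : ∀ {n d} (u : Vertex n d) → rank u ≡ below n d (weight u) + levelBefore u
rank≡below+levelBefore {n} {d} u =
  trans (∑V-cong n d (λ y → 𝟙-lex (weight y) (weight u) (revLexGt y u))) (∑V-distrib-+ n d _ _)
  where
  𝟙-lex : ∀ a b R → 𝟙 ((a <ᵇ b) ∨ ((a ≡ᵇ b) ∧ R)) ≡ 𝟙 (a <ᵇ b) + 𝟙 ((a ≡ᵇ b) ∧ R)
  𝟙-lex zero    zero    R = refl
  𝟙-lex zero    (suc b) R = refl
  𝟙-lex (suc a) zero    R = refl
  𝟙-lex (suc a) (suc b) R = 𝟙-lex a b R

below-suc : ∀ n d m → below n d (suc m) ≡ below n d m + level n d m
below-suc n d m = trans (∑V-cong n d (λ y → 𝟙-<ᵇ-suc (weight y) m)) (∑V-distrib-+ n d _ _)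
  where
  𝟙-<ᵇ-suc : ∀ a m → 𝟙 (a <ᵇ suc m) ≡ 𝟙 (a <ᵇ m) + 𝟙 (a ≡ᵇ m)
  𝟙-<ᵇ-suc zero    zero    = refl
  𝟙-<ᵇ-suc zero    (suc m) = refl
  𝟙-<ᵇ-suc (suc a) zero    = refl
  𝟙-<ᵇ-suc (suc a) (suc m) = 𝟙-<ᵇ-suc a m

level≡levelFrom+levelBefore : ∀ {n d} (u : Vertex n d) → level n d (weight u) ≡ levelFrom u + levelBefore u
level≡levelFrom+levelBefore {n} {d} u =
  trans (∑V-cong n d (λ y → 𝟙-split (weight y ≡ᵇ weight u) (revLexGt y u))) (∑V-distrib-+ n d _ _)
  where
  𝟙-split : ∀ Q R → 𝟙 Q ≡ 𝟙 (Q ∧ not R) + 𝟙 (Q ∧ R)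
  𝟙-split true  true  = refl
  𝟙-split true  false = refl
  𝟙-split false R     = refl

rank-suc-weight : ∀ {n d} (u v : Vertex n d) → weight v ≡ suc (weight u) → rank v ≡ rank u + gap u v
rank-suc-weight {n} {d} u v wv≡1+wu = begin
  rank v                                                     ≡⟨ rank≡below+levelBefore v ⟩
  below n d (weight v) + levelBefore v                       ≡⟨ cong (λ w → below n d w + levelBefore v) wv≡1+wu ⟩
  below n d (suc (weight u)) + levelBefore v                 ≡⟨ cong (_+ levelBefore v) (below-suc n d (weight u)) ⟩
  (below n d (weight u) + level n d (weight u)) + levelBefore v
    ≡⟨ cong (λ z → (below n d (weight u) + z) + levelBefore v) (level≡levelFrom+levelBefore u) ⟩
  (below n d (weight u) + (levelFrom u + levelBefore u)) + levelBefore v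
    ≡⟨ solve 4 (λ l a g h → (l :+ (a :+ g)) :+ h := (l :+ g) :+ (a :+ h)) refl
         (below n d (weight u)) (levelFrom u) (levelBefore u) (levelBefore v) ⟩
  (below n d (weight u) + levelBefore u) + gap u v           ≡⟨ cong (_+ gap u v) (rank≡below+levelBefore u) ⟨
  rank u + gap u v                                           ∎

hales-distance≡gap : ∀ n d (u v : Vertex n d) → weight v ≡ suc (weight u) → ∣ hales n d u - hales n d v ∣ ≡ gap u v
hales-distance≡gap n d u v wv≡1+wu = begin
  ∣ hales n d u - hales n d v ∣   ≡⟨ cong₂ ∣_-_∣ (hales≡suc-rank n d u) (hales≡suc-rank n d v) ⟩
  ∣ rank u - rank v ∣             ≡⟨ cong (∣ rank u -_∣) (rank-suc-weight u v wv≡1+wu) ⟩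
  ∣ rank u - rank u + gap u v ∣   ≡⟨ ∣m-m+n∣≡n (rank u) (gap u v) ⟩
  gap u v                         ∎

∑V-if : ∀ n d (c : Bool) (f : Vertex n d → ℕ) → ∑V n d (λ y → if c then f y else 0) ≡ (if c then ∑V n d f else 0)
∑V-if n d true  f = refl
∑V-if n d false f = ∑V-zero n d

∑V-∷ʳ-split : ∀ n d (f : Vertex n (suc d) → ℕ) (c : ℕ → Bool) W b (g : Vertex n d → ℕ) → b < suc n →
  (∀ s a → f (s ∷ʳ a) ≡ (if c (toℕ a) then 𝟙 (weight s + toℕ a ≡ᵇ W) else 0) + (if toℕ a ≡ᵇ b then g s else 0)) →
  ∑V n (suc d) f ≡ sumTo (suc n) (λ a → if c a then levelShift n d W a else 0) + ∑V n d g
∑V-∷ʳ-split n d f c W b g b≤n f≡ = begin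
  ∑V n (suc d) f
    ≡⟨ ∑V-∷ʳ n d f ⟩
  ∑[ a < suc n ] ∑V n d (λ s → f (s ∷ʳ a))
    ≡⟨ ∑-cong {suc n} (λ a → trans (∑V-cong n d (λ s → f≡ s a))
         (∑V-distrib-+ n d (λ s → if c (toℕ a) then 𝟙 (weight s + toℕ a ≡ᵇ W) else 0)
                           (λ s → if toℕ a ≡ᵇ b then g s else 0))) ⟩
  ∑[ a < suc n ] (∑V n d (λ s → if c (toℕ a) then 𝟙 (weight s + toℕ a ≡ᵇ W) else 0)
                  + ∑V n d (λ s → if toℕ a ≡ᵇ b then g s else 0))
    ≡⟨ ∑-cong {suc n} (λ a → cong₂ _+_ (∑V-if n d (c (toℕ a)) (λ s → 𝟙 (weight s + toℕ a ≡ᵇ W)))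
                                       (∑V-if n d (toℕ a ≡ᵇ b) g)) ⟩
  sumTo (suc n) (λ a → (if c a then levelShift n d W a else 0) + (if a ≡ᵇ b then ∑V n d g else 0))
    ≡⟨ sumTo-distrib-+ (suc n) (λ a → if c a then levelShift n d W a else 0) (λ a → if a ≡ᵇ b then ∑V n d g else 0) ⟩
  sumTo (suc n) (λ a → if c a then levelShift n d W a else 0) + sumTo (suc n) (λ a → if a ≡ᵇ b then ∑V n d g else 0)
    ≡⟨ cong (_ +_) (sumTo-indicator (suc n) b (λ _ → ∑V n d g) b≤n) ⟩
  sumTo (suc n) (λ a → if c a then levelShift n d W a else 0) + ∑V n d g ∎

levelBefore-∷ʳ : ∀ {n d} (t : Vertex n d) (b : Fin (suc n)) →
  levelBefore (t ∷ʳ b) ≡ sumTo (suc n) (λ a → if toℕ b <ᵇ a then levelShift n d (weight t + toℕ b) a else 0) + levelBefore t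
levelBefore-∷ʳ {n} {d} t b = ∑V-∷ʳ-split n d _ (toℕ b <ᵇ_) (weight t + toℕ b) (toℕ b) _ (toℕ<n b) λ s a →
  trans (cong₂ (λ p q → 𝟙 ((p ≡ᵇ weight (t ∷ʳ b)) ∧ q)) (weight-∷ʳ s a) (revLexGt-∷ʳ s t a b))
    (trans (cong (λ w → 𝟙 ((weight s + toℕ a ≡ᵇ w) ∧ ((toℕ b <ᵇ toℕ a) ∨ ((toℕ a ≡ᵇ toℕ b) ∧ revLexGt s t))))
                 (weight-∷ʳ t b))
       (𝟙-split _ _ _ _ _ (≡ᵇ-cancelʳ′ (weight s) (weight t) (toℕ a) (toℕ b)) (<ᵇ-true⇒≡ᵇ-false (toℕ a) (toℕ b))))
  where
  𝟙-split : ∀ X B Q R Z → (Q ≡ true → X ≡ Z) → (B ≡ true → Q ≡ false) →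
    𝟙 (X ∧ (B ∨ (Q ∧ R))) ≡ (if B then 𝟙 X else 0) + (if Q then 𝟙 (Z ∧ R) else 0)
  𝟙-split X     true  Q     R Z X≡Z B⇒¬Q rewrite B⇒¬Q refl =
    trans (cong 𝟙 (∧-identityʳ X)) (sym (+-identityʳ (𝟙 X)))
  𝟙-split X     false true  R Z X≡Z B⇒¬Q rewrite X≡Z refl = refl
  𝟙-split X     false false R Z X≡Z B⇒¬Q = cong 𝟙 (∧-zeroʳ X)

levelFrom-∷ʳ : ∀ {n d} (t : Vertex n d) (b : Fin (suc n)) →
  levelFrom (t ∷ʳ b) ≡ sumTo (suc n) (λ a → if a <ᵇ toℕ b then levelShift n d (weight t + toℕ b) a else 0) + levelFrom t
levelFrom-∷ʳ {n} {d} t b = ∑V-∷ʳ-split n d _ (_<ᵇ toℕ b) (weight t + toℕ b) (toℕ b) _ (toℕ<n b) λ s a →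
  trans (cong₂ (λ p q → 𝟙 ((p ≡ᵇ weight (t ∷ʳ b)) ∧ not q)) (weight-∷ʳ s a) (revLexGt-∷ʳ s t a b))
    (trans (cong (λ w → 𝟙 ((weight s + toℕ a ≡ᵇ w) ∧ not ((toℕ b <ᵇ toℕ a) ∨ ((toℕ a ≡ᵇ toℕ b) ∧ revLexGt s t))))
                 (weight-∷ʳ t b))
       (𝟙-split _ _ _ _ _ _ (≡ᵇ-cancelʳ′ (weight s) (weight t) (toℕ a) (toℕ b))
                  (<ᵇ-true⇒≡ᵇ-false (toℕ a) (toℕ b)) (<ᵇ-trichotomy (toℕ a) (toℕ b))))
  where
  𝟙-split : ∀ X B Q R Z L → (Q ≡ true → X ≡ Z) → (B ≡ true → Q ≡ false) → L ≡ not (B ∨ Q) →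
    𝟙 (X ∧ not (B ∨ (Q ∧ R))) ≡ (if L then 𝟙 X else 0) + (if Q then 𝟙 (Z ∧ not R) else 0)
  𝟙-split X true  Q     R Z L X≡Z B⇒¬Q L≡ rewrite B⇒¬Q refl | L≡ = cong 𝟙 (∧-zeroʳ X)
  𝟙-split X false true  R Z L X≡Z B⇒¬Q L≡ rewrite X≡Z refl | L≡ = refl
  𝟙-split X false false R Z L X≡Z B⇒¬Q L≡ rewrite L≡ =
    trans (cong 𝟙 (∧-identityʳ X)) (sym (+-identityʳ (𝟙 X)))

levelShift-suc : ∀ n d m a → levelShift n d (suc m) (suc a) ≡ levelShift n d m a
levelShift-suc n d m a = ∑V-cong n d (λ y → cong (λ z → 𝟙 (z ≡ᵇ suc m)) (+-suc (weight y) a))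

levelShift-+ : ∀ n d x b → levelShift n d (x + b) b ≡ level n d x
levelShift-+ n d x b = ∑V-cong n d (λ y → cong 𝟙 (≡ᵇ-cancelʳ (weight y) x b))

sumTo-if-<ᵇ-suc : ∀ n (f : ℕ → ℕ) c → c ≤ n →
  sumTo (suc n) (λ a → if a <ᵇ c then f a else 0) ≡ sumTo n (λ a → if a <ᵇ c then f a else 0)
sumTo-if-<ᵇ-suc n f c c≤n = trans (sumTo-suc n (λ a → if a <ᵇ c then f a else 0))
  (trans (cong (λ z → sumTo n (λ a → if a <ᵇ c then f a else 0) + (if z then f n else 0)) (≥⇒<ᵇ-false c≤n))
    (+-identityʳ _))

sumTo-levelShift-shift : ∀ n d c W → sumTo (suc n) (λ a → if c <ᵇ a then levelShift n d (suc W) a else 0)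
                                    ≡ sumTo n (λ a → if c <ᵇ suc a then levelShift n d W a else 0)
sumTo-levelShift-shift n d c W = sumTo-cong-≗ n (λ a → cong (λ z → if c <ᵇ suc a then z else 0) (levelShift-suc n d W a))

gap-∷ʳ-last : ∀ {n d} (t : Vertex n d) (b b₁ : Fin (suc n)) → toℕ b₁ ≡ suc (toℕ b) →
  gap (t ∷ʳ b) (t ∷ʳ b₁) ≡ window n d (weight t + toℕ b)
gap-∷ʳ-last {n} {d} t b b₁ b₁≡1+b = begin
  levelFrom (t ∷ʳ b) + levelBefore (t ∷ʳ b₁)
    ≡⟨ cong₂ _+_ (levelFrom-∷ʳ t b) (levelBefore-∷ʳ t b₁) ⟩
  (sumTo (suc n) (λ a → if a <ᵇ b′ then F a else 0) + levelFrom t)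
    + (sumTo (suc n) (λ a → if toℕ b₁ <ᵇ a then levelShift n d (weight t + toℕ b₁) a else 0) + levelBefore t)
    ≡⟨ cong₂ (λ p q → (p + levelFrom t) + (q + levelBefore t)) (sumTo-if-<ᵇ-suc n F b′ (<⇒≤ b′<n)) upper ⟩
  (S< + levelFrom t) + (S> + levelBefore t)
    ≡⟨ solve 4 (λ p a q g → (p :+ a) :+ (q :+ g) := p :+ ((a :+ g) :+ q)) refl S< (levelFrom t) S> (levelBefore t) ⟩
  S< + ((levelFrom t + levelBefore t) + S>)
    ≡⟨ cong (λ z → S< + (z + S>)) (begin
         levelFrom t + levelBefore t ≡⟨ level≡levelFrom+levelBefore t ⟨
         level n d (weight t)        ≡⟨ levelShift-+ n d (weight t) b′ ⟨
         F b′                        ≡⟨ sumTo-indicator n b′ F b′<n ⟨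
         S≡ ∎) ⟩
  S< + (S≡ + S>)
    ≡⟨ cong (S< +_) (sumTo-distrib-+ n (λ a → if a ≡ᵇ b′ then F a else 0) (λ a → if b′ <ᵇ a then F a else 0)) ⟨
  S< + sumTo n (λ a → (if a ≡ᵇ b′ then F a else 0) + (if b′ <ᵇ a then F a else 0))
    ≡⟨ sumTo-distrib-+ n (λ a → if a <ᵇ b′ then F a else 0)
         (λ a → (if a ≡ᵇ b′ then F a else 0) + (if b′ <ᵇ a then F a else 0)) ⟨
  sumTo n (λ a → (if a <ᵇ b′ then F a else 0) + ((if a ≡ᵇ b′ then F a else 0) + (if b′ <ᵇ a then F a else 0)))
    ≡⟨ sumTo-cong-≗ n (λ a → trichotomy a b′ (F a)) ⟩
  window n d (weight t + b′) ∎
  where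
  b′ = toℕ b
  F = levelShift n d (weight t + b′)
  S< = sumTo n (λ a → if a <ᵇ b′ then F a else 0)
  S≡ = sumTo n (λ a → if a ≡ᵇ b′ then F a else 0)
  S> = sumTo n (λ a → if b′ <ᵇ a then F a else 0)
  b′<n : b′ < n
  b′<n = s<s⁻¹ (subst (_< suc n) b₁≡1+b (toℕ<n b₁))
  upper : sumTo (suc n) (λ a → if toℕ b₁ <ᵇ a then levelShift n d (weight t + toℕ b₁) a else 0) ≡ S>
  upper rewrite b₁≡1+b | +-suc (weight t) b′ = sumTo-levelShift-shift n d (suc b′) (weight t + b′)
  trichotomy : ∀ a b x → (if a <ᵇ b then x else 0) + ((if a ≡ᵇ b then x else 0) + (if b <ᵇ a then x else 0)) ≡ x
  trichotomy zero    zero    x = +-identityʳ x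
  trichotomy zero    (suc b) x = +-identityʳ x
  trichotomy (suc a) zero    x = refl
  trichotomy (suc a) (suc b) x = trichotomy a b x

gap-∷ʳ : ∀ {n d} (t t′ : Vertex n d) (b : Fin (suc n)) → weight t′ ≡ suc (weight t) →
  gap (t ∷ʳ b) (t′ ∷ʳ b) ≡ gap t t′ + window n d (weight t + toℕ b)
gap-∷ʳ {n} {d} t t′ b wt′≡1+wt = begin
  levelFrom (t ∷ʳ b) + levelBefore (t′ ∷ʳ b)
    ≡⟨ cong₂ _+_ (levelFrom-∷ʳ t b) (levelBefore-∷ʳ t′ b) ⟩
  (sumTo (suc n) (λ a → if a <ᵇ b′ then F a else 0) + levelFrom t)
    + (sumTo (suc n) (λ a → if b′ <ᵇ a then levelShift n d (weight t′ + b′) a else 0) + levelBefore t′)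
    ≡⟨ cong₂ (λ p q → (p + levelFrom t) + (q + levelBefore t′)) (sumTo-if-<ᵇ-suc n F b′ (s≤s⁻¹ (toℕ<n b))) upper ⟩
  (S< + levelFrom t) + (S≥ + levelBefore t′)
    ≡⟨ solve 4 (λ p a q g → (p :+ a) :+ (q :+ g) := (a :+ g) :+ (p :+ q)) refl S< (levelFrom t) S≥ (levelBefore t′) ⟩
  gap t t′ + (S< + S≥)
    ≡⟨ cong (gap t t′ +_) (sumTo-distrib-+ n (λ a → if a <ᵇ b′ then F a else 0) (λ a → if b′ <ᵇ suc a then F a else 0)) ⟨
  gap t t′ + sumTo n (λ a → (if a <ᵇ b′ then F a else 0) + (if b′ <ᵇ suc a then F a else 0))
    ≡⟨ cong (gap t t′ +_) (sumTo-cong-≗ n (λ a → dichotomy a b′ (F a))) ⟩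
  gap t t′ + window n d (weight t + b′) ∎
  where
  b′ = toℕ b
  F = levelShift n d (weight t + b′)
  S< = sumTo n (λ a → if a <ᵇ b′ then F a else 0)
  S≥ = sumTo n (λ a → if b′ <ᵇ suc a then F a else 0)
  upper : sumTo (suc n) (λ a → if b′ <ᵇ a then levelShift n d (weight t′ + b′) a else 0) ≡ S≥
  upper rewrite wt′≡1+wt = sumTo-levelShift-shift n d b′ (weight t + b′)
  dichotomy : ∀ a b x → (if a <ᵇ b then x else 0) + (if b <ᵇ suc a then x else 0) ≡ x
  dichotomy zero    zero    x = refl
  dichotomy zero    (suc b) x = +-identityʳ x
  dichotomy (suc a) zero    x = refl
  dichotomy (suc a) (suc b) x = dichotomy a b x

-- Windows of consecutive levels are bounded by R

weight≤ : ∀ {n k} (y : Vertex n k) → weight y ≤ n * k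
weight≤ {n} {zero}  []      = z≤n
weight≤ {n} {suc k} (i ∷ y) = subst (weight (i ∷ y) ≤_) (sym (*-suc n k)) (+-mono-≤ (s≤s⁻¹ (toℕ<n i)) (weight≤ y))

level-beyond : ∀ n k c → n * k < c → level n k c ≡ 0
level-beyond n k c nk<c = trans (∑V-cong n k (λ y → cong 𝟙 (≢⇒≡ᵇ-false (weight y) c
  (λ wy≡c → <⇒≱ nk<c (subst (_≤ n * k) wy≡c (weight≤ y)))))) (∑V-zero n k)

levelShift-< : ∀ n k m a → m < a → levelShift n k m a ≡ 0
levelShift-< n k m a m<a = trans (∑V-cong n k (λ y → cong 𝟙 (≢⇒≡ᵇ-false (weight y + a) m
  (λ e → <⇒≱ m<a (subst (a ≤_) e (m≤n+m a (weight y))))))) (∑V-zero n k)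

levelShift-≥ : ∀ n k m a → a ≤ m → levelShift n k m a ≡ level n k (m ∸ a)
levelShift-≥ n k m a a≤m = trans (cong (λ z → levelShift n k z a) (sym (m∸n+n≡m a≤m))) (levelShift-+ n k (m ∸ a) a)

levelShift≡if : ∀ n k m a → levelShift n k m a ≡ (if m <ᵇ a then 0 else level n k (m ∸ a))
levelShift≡if n k m a with m <ᵇ a in eq
... | true  = levelShift-< n k m a (<ᵇ-true⇒< m a eq)
... | false = levelShift-≥ n k m a (<ᵇ-false⇒≥ m a eq)

level-suc : ∀ n k m → level n (suc k) m ≡ sumTo (suc n) (levelShift n k m)
level-suc n k m = trans (∑V-∷ n k _)
  (∑-cong {suc n} (λ i → ∑V-cong n k (λ y → cong (λ z → 𝟙 (z ≡ᵇ m)) (+-comm (toℕ i) (weight y)))))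

level≡coef : ∀ n k m → level n k m ≡ coef n k m
level≡coef n zero    zero    = refl
level≡coef n zero    (suc m) = refl
level≡coef n (suc k) m       = begin
  level n (suc k) m                                          ≡⟨ level-suc n k m ⟩
  sumTo (suc n) (levelShift n k m)                           ≡⟨ sumTo-cong-≗ (suc n) (λ a →
    trans (levelShift≡if n k m a) (cong (λ z → if m <ᵇ a then 0 else z) (level≡coef n k (m ∸ a)))) ⟩
  sumTo (suc n) (λ j → if m <ᵇ j then 0 else coef n k (m ∸ j)) ≡⟨ sum-map-upTo (suc n) _ ⟨
  coef n (suc k) m                                           ∎

excess : ℕ → ℕ → ℕ → ℕ
excess n k t = sumTo (suc (n * k)) (λ j → level n k j ∸ t)

levelShift∸≡sumTo : ∀ n k W a t →
  levelShift n k W a ∸ t ≡ sumTo (suc (n * k)) (λ j → if j + a ≡ᵇ W then level n k j ∸ t else 0)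
levelShift∸≡sumTo n k W a t with W <ᵇ a in eq
... | true = begin
  levelShift n k W a ∸ t           ≡⟨ cong (_∸ t) (levelShift-< n k W a W<a) ⟩
  0 ∸ t                            ≡⟨ 0∸n≡0 t ⟩
  0                                ≡⟨ sumTo-zero (suc (n * k)) ⟨
  sumTo (suc (n * k)) (λ _ → 0)    ≡⟨ sumTo-cong-≗ (suc (n * k)) (λ j → cong (λ z → if z then level n k j ∸ t else 0)
    (sym (≢⇒≡ᵇ-false (j + a) W (λ e → <⇒≱ W<a (subst (a ≤_) e (m≤n+m a j)))))) ⟩
  sumTo (suc (n * k)) (λ j → if j + a ≡ᵇ W then level n k j ∸ t else 0) ∎
  where W<a = <ᵇ-true⇒< W a eq
... | false = begin
  levelShift n k W a ∸ t    ≡⟨ cong (_∸ t) (levelShift-≥ n k W a a≤W) ⟩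
  level n k (W ∸ a) ∸ t     ≡⟨ as-indicator ⟩
  sumTo (suc (n * k)) (λ j → if j ≡ᵇ W ∸ a then level n k j ∸ t else 0)
    ≡⟨ sumTo-cong-≗ (suc (n * k)) (λ j → cong (λ z → if z then level n k j ∸ t else 0)
         (trans (sym (≡ᵇ-cancelʳ j (W ∸ a) a)) (cong (j + a ≡ᵇ_) (m∸n+n≡m a≤W)))) ⟩
  sumTo (suc (n * k)) (λ j → if j + a ≡ᵇ W then level n k j ∸ t else 0) ∎
  where
  a≤W = <ᵇ-false⇒≥ W a eq
  as-indicator : level n k (W ∸ a) ∸ t ≡ sumTo (suc (n * k)) (λ j → if j ≡ᵇ W ∸ a then level n k j ∸ t else 0)
  as-indicator with W ∸ a <? suc (n * k)
  ... | yes in-range = sym (sumTo-indicator (suc (n * k)) (W ∸ a) (λ j → level n k j ∸ t) in-range)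
  ... | no  beyond   = trans (cong (_∸ t) (level-beyond n k (W ∸ a) (≰⇒> (beyond ∘ s≤s))))
      (trans (0∸n≡0 t) (sym (sumTo-indicator-≥ (suc (n * k)) (W ∸ a) (λ j → level n k j ∸ t) (≮⇒≥ beyond))))

sumTo-if-+≡ᵇ-≤ : ∀ m j W x → sumTo m (λ a → if j + a ≡ᵇ W then x else 0) ≤ x
sumTo-if-+≡ᵇ-≤ m j W x with j ≤? W
... | yes j≤W = subst (_≤ x) (sym (sumTo-cong-≗ m (λ a → cong (λ z → if z then x else 0)
      (trans (cong (j + a ≡ᵇ_) (sym (m+[n∸m]≡n j≤W))) (≡ᵇ-cancelˡ j a (W ∸ j))))))
      (sumTo-indicator-≤ m (W ∸ j) (λ _ → x))
... | no  j≰W = subst (_≤ x) (sym (trans (sumTo-cong-≗ m (λ a → cong (λ z → if z then x else 0)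
      (≢⇒≡ᵇ-false (j + a) W (λ e → j≰W (subst (j ≤_) e (m≤m+n j a)))))) (sumTo-zero m))) z≤n

window≤threshold : ∀ n k W t → window n k W ≤ n * t + excess n k t
window≤threshold n k W t =
  ≤-trans (sumTo-mono n (λ a _ → m≤n+m∸n (levelShift n k W a) t))
    (≤-trans (≤-reflexive regroup)
      (+-monoʳ-≤ (n * t) (sumTo-mono M (λ j _ → sumTo-if-+≡ᵇ-≤ n j W (level n k j ∸ t)))))
  where
  M = suc (n * k)
  regroup : sumTo n (λ a → t + (levelShift n k W a ∸ t))
          ≡ n * t + sumTo M (λ j → sumTo n (λ a → if j + a ≡ᵇ W then level n k j ∸ t else 0))
  regroup = begin
    sumTo n (λ a → t + (levelShift n k W a ∸ t))
      ≡⟨ sumTo-distrib-+ n (λ _ → t) (λ a → levelShift n k W a ∸ t) ⟩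
    sumTo n (λ _ → t) + sumTo n (λ a → levelShift n k W a ∸ t)
      ≡⟨ cong₂ _+_ (sumTo-const n t) (sumTo-cong-≗ n (λ a → levelShift∸≡sumTo n k W a t)) ⟩
    n * t + sumTo n (λ a → sumTo M (λ j → if j + a ≡ᵇ W then level n k j ∸ t else 0))
      ≡⟨ cong (n * t +_) (sumTo-comm n M (λ a j → if j + a ≡ᵇ W then level n k j ∸ t else 0)) ⟩
    n * t + sumTo M (λ j → sumTo n (λ a → if j + a ≡ᵇ W then level n k j ∸ t else 0)) ∎

sum-take≤threshold : ∀ n (xs : List ℕ) t → sum (take n xs) ≤ n * t + sum (map (_∸ t) xs)
sum-take≤threshold zero    xs       t = z≤n
sum-take≤threshold (suc n) []       t = z≤n
sum-take≤threshold (suc n) (x ∷ xs) t = subst (x + sum (take n xs) ≤_) (interchange t (x ∸ t) (n * t) _)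
  (+-mono-≤ (m≤n+m∸n x t) (sum-take≤threshold n xs t))

sum-map-∸-all≤ : ∀ (xs : List ℕ) t → All (_≤ t) xs → sum (map (_∸ t) xs) ≡ 0
sum-map-∸-all≤ []       t []           = refl
sum-map-∸-all≤ (x ∷ xs) t (x≤t ∷ xs≤t) = cong₂ _+_ (m≤n⇒m∸n≡0 x≤t) (sum-map-∸-all≤ xs t xs≤t)

-- The threshold is the first element not taken, or 0 if there is none.
sum-take≡threshold : ∀ n xs → AllPairs _≥_ xs → Σ ℕ λ t → sum (take n xs) ≡ n * t + sum (map (_∸ t) xs)
sum-take≡threshold n []       _     = 0 , trans (cong sum (take-[] n)) (sym (trans (+-identityʳ (n * 0)) (*-zeroʳ n)))
sum-take≡threshold n (x ∷ xs) desc = let t , _ , eq = bounded x xs desc n in t , eq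
  where
  bounded : ∀ x xs → AllPairs _≥_ (x ∷ xs) → ∀ n →
    Σ ℕ λ t → t ≤ x × sum (take n (x ∷ xs)) ≡ n * t + sum (map (_∸ t) (x ∷ xs))
  bounded x xs       (x≥xs ∷ _)  zero    = x , ≤-refl , sym (cong₂ _+_ (n∸n≡0 x) (sum-map-∸-all≤ xs x x≥xs))
  bounded x []       _           (suc n) = 0 , z≤n ,
    trans (cong (λ ys → x + sum ys) (take-[] n)) (sym (cong (_+ (x + 0)) (*-zeroʳ (suc n))))
  bounded x (y ∷ xs) (x≥yxs ∷ desc) (suc n) with bounded y xs desc n | x≥yxs
  ... | t , t≤y , eq | y≤x ∷ _ = t , ≤-trans t≤y y≤x , (begin
    x + sum (take n (y ∷ xs))                                  ≡⟨ cong (x +_) eq ⟩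
    x + (n * t + sum (map (_∸ t) (y ∷ xs)))                    ≡⟨ cong (_+ _) (m+[n∸m]≡n (≤-trans t≤y y≤x)) ⟨
    (t + (x ∸ t)) + (n * t + sum (map (_∸ t) (y ∷ xs)))        ≡⟨ interchange t (x ∸ t) (n * t) _ ⟩
    (t + n * t) + ((x ∸ t) + sum (map (_∸ t) (y ∷ xs)))        ∎)

AllPairs-reverse : ∀ {A : Set} {R : A → A → Set} {xs} → AllPairs R xs → AllPairs (flip R) (reverse xs)
AllPairs-reverse                     []             = []
AllPairs-reverse {R = R} {xs = x ∷ xs} (Rx-xs ∷ Rxs) = subst (AllPairs (flip R)) (sym (unfold-reverse x xs))
  (AllPairs.++⁺ (AllPairs-reverse Rxs) ([] ∷ [])
    (All.map (_∷ []) (Perm.All-resp-↭ (↭-sym (Perm.↭-reverse xs)) Rx-xs)))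

sum-map-∸-coeffs : ∀ n k t → sum (map (_∸ t) (reverse (sort (coeffs n k)))) ≡ excess n k t
sum-map-∸-coeffs n k t = begin
  sum (map (_∸ t) (reverse (sort (coeffs n k))))
    ≡⟨ sum-↭ (Perm.map⁺ (_∸ t) (↭-trans (Perm.↭-reverse (sort (coeffs n k))) (sort-↭ (coeffs n k)))) ⟩
  sum (map (_∸ t) (map (coef n k) (upTo (suc (n * k)))))
    ≡⟨ cong sum (map-∘ (upTo (suc (n * k)))) ⟨
  sum (map (λ j → coef n k j ∸ t) (upTo (suc (n * k))))
    ≡⟨ sum-map-upTo (suc (n * k)) _ ⟩
  sumTo (suc (n * k)) (λ j → coef n k j ∸ t)
    ≡⟨ sumTo-cong-≗ (suc (n * k)) (λ j → cong (_∸ t) (level≡coef n k j)) ⟨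
  excess n k t ∎

R≤threshold : ∀ n k t → R n k ≤ n * t + excess n k t
R≤threshold n k t = subst (R n k ≤_) (cong (n * t +_) (sum-map-∸-coeffs n k t))
  (sum-take≤threshold n (reverse (sort (coeffs n k))) t)

R≡threshold : ∀ n k → Σ ℕ λ t → R n k ≡ n * t + excess n k t
R≡threshold n k =
  let t , eq = sum-take≡threshold n (reverse (sort (coeffs n k)))
                 (AllPairs-reverse (Linked⇒AllPairs ≤-trans (sort-↗ (coeffs n k))))
  in t , trans eq (cong (n * t +_) (sum-map-∸-coeffs n k t))

window≤R : ∀ n k W → window n k W ≤ R n k
window≤R n k W = let t , eq = R≡threshold n k in subst (window n k W ≤_) (sym eq) (window≤threshold n k W t)

Rsum : ℕ → ℕ → ℕ
Rsum n d = sum (map (R n) (upTo d))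

Rsum-suc : ∀ n d → Rsum n (suc d) ≡ Rsum n d + R n d
Rsum-suc n d = begin
  sum (map (R n) (upTo (suc d)))        ≡⟨ cong (λ l → sum (map (R n) l)) (upTo-∷ʳ d) ⟨
  sum (map (R n) (upTo d ++ [ d ]))     ≡⟨ cong sum (map-++ (R n) (upTo d) [ d ]) ⟩
  sum (map (R n) (upTo d) ++ [ R n d ]) ≡⟨ sum-++ (map (R n) (upTo d)) [ R n d ] ⟩
  Rsum n d + (R n d + 0)                ≡⟨ cong (Rsum n d +_) (+-identityʳ (R n d)) ⟩
  Rsum n d + R n d                      ∎

gap≤Rsum : ∀ n d (u v : Vertex n d) → adjᵇ u v ≡ true → weight v ≡ suc (weight u) → gap u v ≤ Rsum n d
gap≤Rsum n zero    []  []  ()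
gap≤Rsum n (suc d) u v adj wv≡1+wu with initLast u | initLast v
... | t , b , refl | t′ , b′ , refl
    with ∨≡true {eqV t t′ ∧ (∣ toℕ b - toℕ b′ ∣ ≡ᵇ 1)} (trans (sym (adjᵇ-∷ʳ t t′ b b′)) adj)
... | inj₁ last-differs with eqV-true⇒≡ t t′ (proj₁ (∧≡true {eqV t t′} last-differs))
...   | refl = subst (_≤ Rsum n (suc d)) (sym (gap-∷ʳ-last t b b′ b′≡1+b))
                 (subst (window n d (weight t + toℕ b) ≤_) (sym (Rsum-suc n d))
                   (≤-trans (window≤R n d _) (m≤n+m (R n d) (Rsum n d))))
  where
  b′≡1+b : toℕ b′ ≡ suc (toℕ b)
  b′≡1+b = +-cancelˡ-≡ (weight t) (toℕ b′) (suc (toℕ b))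
    (trans (sym (weight-∷ʳ t b′)) (trans wv≡1+wu (trans (cong suc (weight-∷ʳ t b)) (sym (+-suc (weight t) (toℕ b))))))
gap≤Rsum n (suc d) u v adj wv≡1+wu | t , b , refl | t′ , b′ , refl | inj₂ last-equal
    with ∧≡true {toℕ b ≡ᵇ toℕ b′} last-equal
... | b≡b′ , adj′ with toℕ-injective {i = b} {j = b′} (≡ᵇ-true⇒≡ _ _ b≡b′)
...   | refl = subst (_≤ Rsum n (suc d)) (sym (gap-∷ʳ t t′ b wt′≡1+wt))
                 (subst (gap t t′ + window n d (weight t + toℕ b) ≤_) (sym (Rsum-suc n d))
                   (+-mono-≤ (gap≤Rsum n d t t′ adj′ wt′≡1+wt) (window≤R n d _)))
  where
  wt′≡1+wt : weight t′ ≡ suc (weight t)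
  wt′≡1+wt = +-cancelʳ-≡ (toℕ b) (weight t′) (suc (weight t))
    (trans (sym (weight-∷ʳ t′ b)) (trans wv≡1+wu (cong suc (weight-∷ʳ t b))))

hales-adjacent≤Rsum : ∀ n d (u v : Vertex n d) → adjᵇ u v ≡ true → ∣ hales n d u - hales n d v ∣ ≤ Rsum n d
hales-adjacent≤Rsum n d u v adj with adjᵇ⇒weight-suc u v adj
... | inj₁ wv≡1+wu = subst (_≤ Rsum n d) (sym (hales-distance≡gap n d u v wv≡1+wu)) (gap≤Rsum n d u v adj wv≡1+wu)
... | inj₂ wu≡1+wv = subst (_≤ Rsum n d)
        (sym (trans (∣-∣-comm (hales n d u) (hales n d v)) (hales-distance≡gap n d v u wu≡1+wv)))
        (gap≤Rsum n d v u (trans (adjᵇ-sym v u) adj) wu≡1+wv)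

maximum : List ℕ → ℕ
maximum = foldr _⊔_ 0

maximum-++ : ∀ xs ys → maximum (xs ++ ys) ≡ maximum xs ⊔ maximum ys
maximum-++ []       ys = refl
maximum-++ (x ∷ xs) ys = trans (cong (x ⊔_) (maximum-++ xs ys)) (sym (⊔-assoc x _ _))

maximum-concatMap-≤ : ∀ {A : Set} (f : A → List ℕ) xs m → (∀ x → maximum (f x) ≤ m) → maximum (concatMap f xs) ≤ m
maximum-concatMap-≤ f []       m fx≤m = z≤n
maximum-concatMap-≤ f (x ∷ xs) m fx≤m = subst (_≤ m) (sym (maximum-++ (f x) (concatMap f xs)))
  (⊔-lub (fx≤m x) (maximum-concatMap-≤ f xs m fx≤m))

∈⇒maximum-≤ : ∀ {A : Set} (f : A → List ℕ) {xs x} → x ∈ xs → maximum (f x) ≤ maximum (concatMap f xs)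
∈⇒maximum-≤ f {x ∷ xs} (here refl) = subst (maximum (f x) ≤_) (sym (maximum-++ (f x) (concatMap f xs))) (m≤m⊔n _ _)
∈⇒maximum-≤ f {y ∷ xs} (there x∈xs) = subst (_ ≤_) (sym (maximum-++ (f y) (concatMap f xs)))
  (≤-trans (∈⇒maximum-≤ f x∈xs) (m≤n⊔m _ _))

∈-vertices : ∀ n d (x : Vertex n d) → x ∈ vertices n d
∈-vertices n zero    []       = here refl
∈-vertices n (suc d) (i ∷ xs) =
  ∈-concatMap⁺ (λ j → map (j ∷_) (vertices n d)) (lose (∈-allFin i) (∈-map⁺ (i ∷_) (∈-vertices n d xs)))

bw≤ : ∀ n d (f : Vertex n d → ℕ) m → (∀ u v → adjᵇ u v ≡ true → ∣ f u - f v ∣ ≤ m) → bw n d f ≤ m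
bw≤ n d f m adj⇒≤ = maximum-concatMap-≤ _ (vertices n d) m (λ u → maximum-concatMap-≤ _ (vertices n d) m (edge≤ u))
  where
  edge≤ : ∀ u v → maximum (if adjᵇ u v then [ ∣ f u - f v ∣ ] else []) ≤ m
  edge≤ u v with adjᵇ u v in adj
  ... | true  = subst (_≤ m) (sym (⊔-identityʳ _)) (adj⇒≤ u v adj)
  ... | false = z≤n

≤bw : ∀ n d (f : Vertex n d → ℕ) u v → adjᵇ u v ≡ true → ∣ f u - f v ∣ ≤ bw n d f
≤bw n d f u v adj = ≤-trans edge
  (≤-trans (∈⇒maximum-≤ (λ v → if adjᵇ u v then [ ∣ f u - f v ∣ ] else []) (∈-vertices n d v))
     (∈⇒maximum-≤ (λ u → concatMap (λ v → if adjᵇ u v then [ ∣ f u - f v ∣ ] else []) (vertices n d)) (∈-vertices n d u)))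
  where
  edge : ∣ f u - f v ∣ ≤ maximum (if adjᵇ u v then [ ∣ f u - f v ∣ ] else [])
  edge rewrite adj = m≤m⊔n _ 0

-- Symmetry and unimodality of the levels

reflect : ∀ {n k} → Vertex n k → Vertex n k
reflect = Vec.map opposite

∑V-reflect : ∀ n k (f : Vertex n k → ℕ) → ∑V n k f ≡ ∑V n k (f ∘ reflect)
∑V-reflect n zero    f = refl
∑V-reflect n (suc k) f = begin
  ∑V n (suc k) f                                          ≡⟨ ∑V-∷ n k f ⟩
  ∑[ i < suc n ] ∑V n k (λ y → f (i ∷ y))                 ≡⟨ ∑-cong {suc n} (λ i → ∑V-reflect n k (λ y → f (i ∷ y))) ⟩
  ∑[ i < suc n ] ∑V n k (λ y → f (i ∷ reflect y))         ≡⟨ sum-permute (λ i → ∑V n k (λ y → f (i ∷ reflect y))) reversal ⟩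
  ∑[ i < suc n ] ∑V n k (λ y → f (opposite i ∷ reflect y)) ≡⟨ ∑V-∷ n k (f ∘ reflect) ⟨
  ∑V n (suc k) (f ∘ reflect)                              ∎

weight-reflect : ∀ {n k} (y : Vertex n k) → weight (reflect y) + weight y ≡ n * k
weight-reflect {n} []                = sym (*-zeroʳ n)
weight-reflect {n} {suc k} (i ∷ y) = begin
  (toℕ (opposite i) + weight (reflect y)) + (toℕ i + weight y) ≡⟨ interchange (toℕ (opposite i)) _ _ _ ⟩
  (toℕ (opposite i) + toℕ i) + (weight (reflect y) + weight y) ≡⟨ cong₂ _+_ opposite+i≡n (weight-reflect y) ⟩
  n + n * k                                                    ≡⟨ *-suc n k ⟨
  n * suc k                                                    ∎
  where
  opposite+i≡n : toℕ (opposite i) + toℕ i ≡ n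
  opposite+i≡n = trans (cong (_+ toℕ i) (opposite-prop i)) (m∸n+n≡m (s≤s⁻¹ (toℕ<n i)))

level-symmetric : ∀ n k m → m ≤ n * k → level n k m ≡ level n k (n * k ∸ m)
level-symmetric n k m m≤nk = trans (∑V-reflect n k _) (∑V-cong n k (λ y → cong 𝟙 (≡ᵇ-cong-⇔
  (λ wry≡m → trans (sym (m+n∸m≡n (weight (reflect y)) (weight y))) (cong₂ _∸_ (weight-reflect y) wry≡m))
  (λ wy≡ → trans (sym (m+n∸n≡m (weight (reflect y)) (weight y)))
             (trans (cong₂ _∸_ (weight-reflect y) wy≡) (m∸[m∸n]≡n m≤nk))))))

Unimodal : ℕ → ℕ → Set
Unimodal n k = ∀ j → suc (j + j) ≤ n * k → level n k j ≤ level n k (suc j)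

module _ {n k : ℕ} (unimodal-k : Unimodal n k) where

  level-mono-lower-half : ∀ a b → b ≤ a → a + a ≤ n * k → level n k b ≤ level n k a
  level-mono-lower-half zero    zero b≤a _ = ≤-refl
  level-mono-lower-half (suc a) b    b≤a h with m≤n⇒m<n∨m≡n b≤a
  ... | inj₂ refl = ≤-refl
  ... | inj₁ b<1+a = ≤-trans (level-mono-lower-half a b (s≤s⁻¹ b<1+a) (≤-trans (n≤1+n _) 1+2a≤nk)) (unimodal-k a 1+2a≤nk)
    where
    1+2a≤nk : suc (a + a) ≤ n * k
    1+2a≤nk = ≤-trans (s≤s (+-monoʳ-≤ a (n≤1+n a))) h

  level-≤-inner : ∀ a b → b ≤ a → a + b ≤ n * k → level n k b ≤ level n k a
  level-≤-inner a b b≤a a+b≤nk with a + a ≤? n * k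
  ... | yes 2a≤nk = level-mono-lower-half a b b≤a 2a≤nk
  ... | no  2a≰nk = subst (level n k b ≤_) (sym (level-symmetric n k a a≤nk)) (level-mono-lower-half c b b≤c 2c≤nk)
    where
    a≤nk = ≤-trans (m≤m+n a b) a+b≤nk
    c = n * k ∸ a
    c+a≡nk : c + a ≡ n * k
    c+a≡nk = m∸n+n≡m a≤nk
    b≤c : b ≤ c
    b≤c = +-cancelʳ-≤ a b c (subst₂ _≤_ (+-comm a b) (sym c+a≡nk) a+b≤nk)
    c<a : c < a
    c<a = +-cancelʳ-< a c a (subst (_< a + a) (sym c+a≡nk) (≰⇒> 2a≰nk))
    2c≤nk : c + c ≤ n * k
    2c≤nk = ≤-trans (+-monoʳ-≤ c (<⇒≤ c<a)) (≤-reflexive c+a≡nk)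

  level-≤-inner′ : ∀ a b → a ≤ b → n * k ≤ a + b → level n k b ≤ level n k a
  level-≤-inner′ a b a≤b nk≤a+b with b ≤? n * k
  ... | no  b≰nk = subst (_≤ level n k a) (sym (level-beyond n k b (≰⇒> b≰nk))) z≤n
  ... | yes b≤nk = subst (_≤ level n k a) (sym (level-symmetric n k b b≤nk)) (level-≤-inner a c c≤a a+c≤nk)
    where
    c = n * k ∸ b
    c+b≡nk : c + b ≡ n * k
    c+b≡nk = m∸n+n≡m b≤nk
    c≤a : c ≤ a
    c≤a = +-cancelʳ-≤ b c a (subst (_≤ a + b) (sym c+b≡nk) nk≤a+b)
    a+c≤nk : a + c ≤ n * k
    a+c≤nk = ≤-trans (+-monoˡ-≤ c a≤b) (≤-reflexive (trans (+-comm b c) c+b≡nk))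

-- level (k+1) (j+1) - level (k+1) j = level k (j+1) - level k (j - n), and j - n is further
-- from the centre n k / 2 than j + 1.
unimodal-suc : ∀ n k → Unimodal n k → Unimodal n (suc k)
unimodal-suc n k unimodal-k j 1+2j≤n+nk = subst₂ _≤_
  (sym (trans (level-suc n k j) (sumTo-suc n (levelShift n k j))))
  (sym (trans (level-suc n k (suc j)) (cong₂ _+_ (levelShift-≥ n k (suc j) 0 z≤n) (sumTo-cong-≗ n (levelShift-suc n k j)))))
  (subst (sumTo n (levelShift n k j) + levelShift n k j n ≤_) (+-comm (sumTo n (levelShift n k j)) _)
    (+-monoʳ-≤ (sumTo n (levelShift n k j)) dropped≤added))
  where
  dropped≤added : levelShift n k j n ≤ level n k (suc j)
  dropped≤added with n ≤? j
  ... | no  n≰j = subst (_≤ level n k (suc j)) (sym (levelShift-< n k j n (≰⇒> n≰j))) z≤n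
  ... | yes n≤j = subst (_≤ level n k (suc j)) (sym (levelShift-≥ n k j n n≤j))
        (level-≤-inner {n} {k} unimodal-k (suc j) (j ∸ n) (≤-trans (m∸n≤m j n) (n≤1+n j)) close)
    where
    r = j ∸ n
    r+n≡j : r + n ≡ j
    r+n≡j = m∸n+n≡m n≤j
    close : suc j + r ≤ n * k
    close = subst (λ z → suc z + r ≤ n * k) r+n≡j (+-cancelˡ-≤ n _ _ (subst (_≤ n + n * k)
      (solve 2 (λ r n → con 1 :+ ((r :+ n) :+ (r :+ n)) := n :+ ((con 1 :+ (r :+ n)) :+ r)) refl r n)
      (subst (λ z → suc (z + z) ≤ n + n * k) (sym r+n≡j) (subst (suc (j + j) ≤_) (*-suc n k) 1+2j≤n+nk))))

unimodal : ∀ n k → Unimodal n k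
unimodal n zero    j 1+2j≤0 with subst (suc (j + j) ≤_) (*-zeroʳ n) 1+2j≤0
... | ()
unimodal n (suc k) = unimodal-suc n k (unimodal n k)

-- With t the size of level p, the levels inside the window p, …, p - n + 1 have size ≥ t and
-- those outside ≤ t, so the window attains the threshold bound n t + excess n k t ≥ R n k.
window-central≡R : ∀ n k p → n * k + n ≤ suc (p + p) → p + p ≤ n * k + n → window n k p ≡ R n k
window-central≡R n k p upper lower =
  ≤-antisym (window≤R n k p) (subst (R n k ≤_) (sym window≡threshold) (R≤threshold n k t))
  where
  K = n * k
  t = level n k p
  excess-p = λ j → level n k j ∸ t

  inside≥t : ∀ a → a < n → t ≤ levelShift n k p a
  inside≥t a a<n with a ≤? p
  ... | yes a≤p = subst (t ≤_) (sym (levelShift-≥ n k p a a≤p))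
      (level-≤-inner′ {n} {k} (unimodal n k) (p ∸ a) p (m∸n≤m p a)
        (subst (λ z → K ≤ (p ∸ a) + z) (m∸n+n≡m a≤p) K≤q+[q+a]))
    where
    q = p ∸ a
    K≤q+[q+a] : K ≤ q + (q + a)
    K≤q+[q+a] = +-cancelʳ-≤ n K (q + (q + a))
      (≤-trans (subst (λ z → K + n ≤ suc (z + z)) (sym (m∸n+n≡m a≤p)) upper)
        (subst (_≤ (q + (q + a)) + n)
          (solve 2 (λ q a → (q :+ (q :+ a)) :+ (con 1 :+ a) := con 1 :+ ((q :+ a) :+ (q :+ a))) refl q a)
          (+-monoʳ-≤ (q + (q + a)) a<n)))
  ... | no  a≰p = subst₂ _≤_ (sym (level-beyond n k p K<p)) (sym (levelShift-< n k p a p<a)) z≤n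
    where
    p<a = ≰⇒> a≰p
    K<p : K < p
    K<p = +-cancelʳ-≤ p (suc K) p (+-cancelʳ-≤ 1 (suc K + p) (p + p)
      (subst₂ _≤_ (solve 2 (λ K p → K :+ (con 1 :+ (con 1 :+ p)) := ((con 1 :+ K) :+ p) :+ con 1) refl K p)
                  (+-comm 1 (p + p))
        (≤-trans (+-monoʳ-≤ K (≤-trans (s≤s p<a) a<n)) upper)))

  outside≤t : ∀ j → (p < j) ⊎ (j + n ≤ p) → level n k j ≤ t
  outside≤t j (inj₁ p<j)   = level-≤-inner′ {n} {k} (unimodal n k) p j (<⇒≤ p<j)
    (≤-trans (m≤m+n K n) (≤-trans upper (subst (_≤ p + j) (+-suc p p) (+-monoʳ-≤ p p<j))))
  outside≤t j (inj₂ j+n≤p) = level-≤-inner {n} {k} (unimodal n k) p j (≤-trans (m≤m+n j n) j+n≤p)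
    (+-cancelʳ-≤ n (p + j) K (≤-trans (subst (_≤ p + p) (sym (+-assoc p j n)) (+-monoʳ-≤ p j+n≤p)) lower))

  diagonal : ∀ j → sumTo n (λ a → if j + a ≡ᵇ p then excess-p j else 0) ≡ excess-p j
  diagonal j with j ≤? p
  ... | no  j≰p = trans (sumTo-cong-≗ n (λ a → cong (λ z → if z then excess-p j else 0)
                    (≢⇒≡ᵇ-false (j + a) p (λ e → j≰p (subst (j ≤_) e (m≤m+n j a))))))
                  (trans (sumTo-zero n) (sym (m≤n⇒m∸n≡0 (outside≤t j (inj₁ (≰⇒> j≰p))))))
  ... | yes j≤p = trans (sumTo-cong-≗ n (λ a → cong (λ z → if z then excess-p j else 0)
                    (trans (cong (j + a ≡ᵇ_) (sym (m+[n∸m]≡n j≤p))) (≡ᵇ-cancelˡ j a (p ∸ j))))) in-window?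
    where
    in-window? : sumTo n (λ a → if a ≡ᵇ p ∸ j then excess-p j else 0) ≡ excess-p j
    in-window? with p ∸ j <? n
    ... | yes p∸j<n = sumTo-indicator n (p ∸ j) (λ _ → excess-p j) p∸j<n
    ... | no  p∸j≮n = trans (sumTo-indicator-≥ n (p ∸ j) (λ _ → excess-p j) (≮⇒≥ p∸j≮n))
        (sym (m≤n⇒m∸n≡0 (outside≤t j (inj₂ (subst (j + n ≤_) (m+[n∸m]≡n j≤p) (+-monoʳ-≤ j (≮⇒≥ p∸j≮n)))))))

  window≡threshold : window n k p ≡ n * t + excess n k t
  window≡threshold = begin
    sumTo n (levelShift n k p)                         ≡⟨ sumTo-cong n (λ a a<n → sym (m+[n∸m]≡n (inside≥t a a<n))) ⟩
    sumTo n (λ a → t + (levelShift n k p a ∸ t))       ≡⟨ sumTo-distrib-+ n (λ _ → t) (λ a → levelShift n k p a ∸ t) ⟩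
    sumTo n (λ _ → t) + sumTo n (λ a → levelShift n k p a ∸ t)
      ≡⟨ cong₂ _+_ (sumTo-const n t) (sumTo-cong-≗ n (λ a → levelShift∸≡sumTo n k p a t)) ⟩
    n * t + sumTo n (λ a → sumTo (suc K) (λ j → if j + a ≡ᵇ p then excess-p j else 0))
      ≡⟨ cong (n * t +_) (sumTo-comm n (suc K) (λ a j → if j + a ≡ᵇ p then excess-p j else 0)) ⟩
    n * t + sumTo (suc K) (λ j → sumTo n (λ a → if j + a ≡ᵇ p then excess-p j else 0))
      ≡⟨ cong (n * t +_) (sumTo-cong-≗ (suc K) diagonal) ⟩
    n * t + excess n k t                               ∎

-- An edge realising every central window

⌊/2⌋+⌊/2⌋≤ : ∀ m → ⌊ m /2⌋ + ⌊ m /2⌋ ≤ m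
⌊/2⌋+⌊/2⌋≤ zero          = z≤n
⌊/2⌋+⌊/2⌋≤ (suc zero)    = z≤n
⌊/2⌋+⌊/2⌋≤ (suc (suc m)) = s≤s (subst (_≤ suc m) (sym (+-suc ⌊ m /2⌋ ⌊ m /2⌋)) (s≤s (⌊/2⌋+⌊/2⌋≤ m)))

≤suc[⌊/2⌋+⌊/2⌋] : ∀ m → m ≤ suc (⌊ m /2⌋ + ⌊ m /2⌋)
≤suc[⌊/2⌋+⌊/2⌋] zero          = z≤n
≤suc[⌊/2⌋+⌊/2⌋] (suc zero)    = s≤s z≤n
≤suc[⌊/2⌋+⌊/2⌋] (suc (suc m)) =
  s≤s (subst (suc m ≤_) (cong suc (sym (+-suc ⌊ m /2⌋ ⌊ m /2⌋))) (s≤s (≤suc[⌊/2⌋+⌊/2⌋] m)))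

double-≤-suc-double : ∀ x y → x + x ≤ suc (y + y) → x ≤ y
double-≤-suc-double zero    y       _       = z≤n
double-≤-suc-double (suc x) zero    (s≤s h) with () ← subst (_≤ 0) (+-suc x x) h
double-≤-suc-double (suc x) (suc y) (s≤s h) =
  s≤s (double-≤-suc-double x y (s≤s⁻¹ (subst₂ _≤_ (+-suc x x) (cong suc (+-suc y y)) h)))

⌊/2⌋<-nonzero : ∀ {m} → 1 ≤ m → ⌊ m /2⌋ < m
⌊/2⌋<-nonzero {suc m} _ = ⌊n/2⌋<n m

-- The prefixes of low d have the central weights centre 0, …, centre d; high d only raises the
-- first coordinate, so gap-∷ʳ adds the central window in every dimension.
module CentralEdge (n : ℕ) (n≥1 : 1 ≤ n) where

  centre : ℕ → ℕ
  centre k = ⌊ n * k + n /2⌋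

  centre-mono : ∀ k → centre k ≤ centre (suc k)
  centre-mono k = double-≤-suc-double (centre k) (centre (suc k))
    (≤-trans (⌊/2⌋+⌊/2⌋≤ _) (≤-trans (+-monoˡ-≤ n (*-monoʳ-≤ n (n≤1+n k))) (≤suc[⌊/2⌋+⌊/2⌋] _)))

  centre-step : ∀ k → centre (suc k) ≤ centre k + n
  centre-step k = double-≤-suc-double (centre (suc k)) (centre k + n)
    (≤-trans (⌊/2⌋+⌊/2⌋≤ (n * suc k + n))
      (subst (_≤ suc ((centre k + n) + (centre k + n))) (cong (_+ n) (trans (+-comm (n * k) n) (sym (*-suc n k))))
        (≤-trans (+-monoˡ-≤ n (≤suc[⌊/2⌋+⌊/2⌋] (n * k + n)))
          (≤-trans (s≤s (m≤m+n _ n))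
            (≤-reflexive (cong suc (solve 2 (λ c n → ((c :+ c) :+ n) :+ n := (c :+ n) :+ (c :+ n)) refl (centre k) n)))))))

  centre0<n : centre 0 < n
  centre0<n = subst (λ m → ⌊ m /2⌋ < n) (sym (cong (_+ n) (*-zeroʳ n))) (⌊/2⌋<-nonzero n≥1)

  digit : ℕ → ℕ
  digit zero    = centre 0
  digit (suc k) = centre (suc k) ∸ centre k

  digit≤n : ∀ k → digit k < suc n
  digit≤n zero    = m<n⇒m<1+n centre0<n
  digit≤n (suc k) = s≤s (≤-trans (∸-monoˡ-≤ (centre k) (centre-step k)) (≤-reflexive (m+n∸m≡n (centre k) n)))

  first-low first-high : Fin (suc n)
  first-low  = fromℕ< (digit≤n 0)
  first-high = fromℕ< (s≤s centre0<n)

  next-digit : ℕ → Fin (suc n)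
  next-digit d = fromℕ< (digit≤n (suc d))

  low high : ∀ d → Vertex n (suc d)
  low  zero    = first-low ∷ []
  low  (suc d) = low d ∷ʳ next-digit d
  high zero    = first-high ∷ []
  high (suc d) = high d ∷ʳ next-digit d

  centre+digit : ∀ d → centre d + toℕ (next-digit d) ≡ centre (suc d)
  centre+digit d = trans (cong (centre d +_) (toℕ-fromℕ< (digit≤n (suc d)))) (m+[n∸m]≡n (centre-mono d))

  weight-low : ∀ d → weight (low d) ≡ centre d
  weight-low zero    = trans (+-identityʳ (toℕ first-low)) (toℕ-fromℕ< (digit≤n 0))
  weight-low (suc d) = trans (weight-∷ʳ (low d) (next-digit d))
    (trans (cong (_+ toℕ (next-digit d)) (weight-low d)) (centre+digit d))

  weight-high : ∀ d → weight (high d) ≡ suc (weight (low d))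
  weight-high d = trans (weight-high-centre d) (cong suc (sym (weight-low d)))
    where
    weight-high-centre : ∀ d → weight (high d) ≡ suc (centre d)
    weight-high-centre zero    = trans (+-identityʳ (toℕ first-high)) (toℕ-fromℕ< (s≤s centre0<n))
    weight-high-centre (suc d) = trans (weight-∷ʳ (high d) (next-digit d))
      (trans (cong (_+ toℕ (next-digit d)) (weight-high-centre d)) (cong suc (centre+digit d)))

  low-adjacent-high : ∀ d → adjᵇ (low d) (high d) ≡ true
  low-adjacent-high zero = trans (adjᵇ-∷ʳ [] [] first-low first-high)
    (cong (λ z → z ∨ ((toℕ first-low ≡ᵇ toℕ first-high) ∧ false)) (≡⇒≡ᵇ-true (begin
      ∣ toℕ first-low - toℕ first-high ∣ ≡⟨ cong₂ ∣_-_∣ (toℕ-fromℕ< (digit≤n 0)) (toℕ-fromℕ< (s≤s centre0<n)) ⟩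
      ∣ centre 0 - suc (centre 0) ∣     ≡⟨ cong (∣ centre 0 -_∣) (+-comm 1 (centre 0)) ⟩
      ∣ centre 0 - centre 0 + 1 ∣       ≡⟨ ∣m-m+n∣≡n (centre 0) 1 ⟩
      1                                 ∎)))
  low-adjacent-high (suc d) = trans (adjᵇ-∷ʳ (low d) (high d) b b)
    (trans (cong (eqV (low d) (high d) ∧ (∣ toℕ b - toℕ b ∣ ≡ᵇ 1) ∨_)
                 (cong₂ _∧_ (≡ᵇ-refl (toℕ b)) (low-adjacent-high d)))
      (∨-zeroʳ _))
    where b = next-digit d

  gap-low-high : ∀ d → gap (low d) (high d) ≡ Rsum n (suc d)
  gap-low-high zero = begin
    gap (low 0) (high 0)          ≡⟨ gap-∷ʳ-last {n} {0} [] first-low first-high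
                                       (trans (toℕ-fromℕ< (s≤s centre0<n)) (cong suc (sym (toℕ-fromℕ< (digit≤n 0))))) ⟩
    window n 0 (toℕ first-low)    ≡⟨ cong (window n 0) (toℕ-fromℕ< (digit≤n 0)) ⟩
    window n 0 (centre 0)         ≡⟨ window-central≡R n 0 (centre 0) (≤suc[⌊/2⌋+⌊/2⌋] _) (⌊/2⌋+⌊/2⌋≤ _) ⟩
    R n 0                         ≡⟨ +-identityʳ (R n 0) ⟨
    Rsum n 1                      ∎
  gap-low-high (suc d) = begin
    gap (low d ∷ʳ b) (high d ∷ʳ b)                              ≡⟨ gap-∷ʳ (low d) (high d) b (weight-high d) ⟩
    gap (low d) (high d) + window n (suc d) (weight (low d) + toℕ b)
      ≡⟨ cong₂ _+_ (gap-low-high d) (cong (window n (suc d)) (trans (cong (_+ toℕ b) (weight-low d)) (centre+digit d))) ⟩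
    Rsum n (suc d) + window n (suc d) (centre (suc d))
      ≡⟨ cong (Rsum n (suc d) +_) (window-central≡R n (suc d) _ (≤suc[⌊/2⌋+⌊/2⌋] _) (⌊/2⌋+⌊/2⌋≤ _)) ⟩
    Rsum n (suc d) + R n (suc d)                                ≡⟨ Rsum-suc n (suc d) ⟨
    Rsum n (suc (suc d))                                        ∎
    where b = next-digit d

mainTheorem2 : (n d : ℕ) → 2 ≤ n → 1 ≤ d →
    bw n d (hales n d) ≡ sum (map (R n) (upTo d))
mainTheorem2 n (suc d) 2≤n _ = ≤-antisym
  (bw≤ n (suc d) (hales n (suc d)) (Rsum n (suc d)) (hales-adjacent≤Rsum n (suc d)))
  (subst (_≤ bw n (suc d) (hales n (suc d)))
    (trans (hales-distance≡gap n (suc d) (low d) (high d) (weight-high d)) (gap-low-high d))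
    (≤bw n (suc d) (hales n (suc d)) (low d) (high d) (low-adjacent-high d)))
  where open CentralEdge n (≤-trans (s≤s z≤n) 2≤n)
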